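{- For any finite abelian group $G$, we have $\Theta(H_{\mathrm{cor},G})\geq |G|^{3/2}$.
   Context: A directed $k$-uniform hypergraph is a pair $H=(V,E)$ with $V$ finite and $E$ a set of $k$-tuples of elements of $V$. The strong product $G\boxtimes H$ has vertex set $V_G\times V_H$, and $((g_1,h_1),\dots,(g_k,h_k))$ is an edge iff either ($g_1=\dots=g_k$ and $(h_1,\dots,h_k)\in E_H$), or ($(g_1,\dots,g_k)\in E_G$ and $h_1=\dots=h_k$), or both $(g_1,\dots,g_k)\in E_G$ and $(h_1,\dots,h_k)\in E_H$. $H^{\boxtimes n}$ is the $n$-fold strong product. An independent set is $S\subseteq V$ such that no edge has all coordinates in $S$; $\alpha(H)$ is the maximum size of an independent set; $\Theta(H)=\lim_{n\to\infty}\alpha(H^{\boxtimes n})^{1/n}$ (the Shannon capacity). For a finite abelian group $G$, $H_{\mathrm{cor},G}$ is the directed $3$-uniform hypergraph with vertex set $G\times G$ and edges $((g_1,g_2),(g_1+\lambda,g_2),(g_1,g_2+\lambda))$ for all $g_1,g_2,\lambda\in G$ with $\lambda\neq 0$. -}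

module Defs where

open import Level using (Level; _⊔_; 0ℓ)
open import Data.Nat using (ℕ; zero; suc)
open import Data.Fin using (Fin; zero; suc)
open import Data.Product using (Σ; _×_; _,_; proj₁; proj₂; ∃-syntax)
open import Data.Sum using (_⊎_)
open import Data.List using (List)
open import Data.Unit.Polymorphic using (⊤)
open import Data.Empty.Polymorphic using (⊥)
open import Relation.Nullary using (¬_)
open import Relation.Binary using (Setoid)
open import Data.Product.Relation.Binary.Pointwise.NonDependent using (×-setoid)
open import Data.List.Relation.Unary.AllPairs using (AllPairs)
import Data.List.Membership.Setoid as SetoidMembership
open import Algebra.Bundles using (AbelianGroup)

-- A directed k-uniform hypergraph: a vertex setoid together with a predicate
-- on k-tuples (Fin k → V) saying which tuples are edges.
record Hypergraph (k : ℕ) (c ℓ : Level) : Set (Level.suc (c ⊔ ℓ)) where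
  field
    vertices : Setoid c ℓ
  open Setoid vertices public renaming (Carrier to V)
  field
    Edge : (Fin k → V) → Set (c ⊔ ℓ)

open Hypergraph using (vertices; Edge; V)

AllEqual : ∀ {c ℓ} (S : Setoid c ℓ) {k : ℕ} → (Fin k → Setoid.Carrier S) → Set ℓ
AllEqual S f = ∀ i j → Setoid._≈_ S (f i) (f j)

_⊠_ : ∀ {k c ℓ} → Hypergraph k c ℓ → Hypergraph k c ℓ → Hypergraph k c ℓ
vertices (G ⊠ H) = ×-setoid (vertices G) (vertices H)
Edge (G ⊠ H) e =
    (AllEqual (vertices G) (λ i → proj₁ (e i)) × Edge H (λ i → proj₂ (e i)))
  ⊎ (Edge G (λ i → proj₁ (e i)) × AllEqual (vertices H) (λ i → proj₂ (e i)))
  ⊎ (Edge G (λ i → proj₁ (e i)) × Edge H (λ i → proj₂ (e i)))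

unitHG : ∀ {k c ℓ} → Hypergraph k c ℓ
vertices (unitHG {c = c} {ℓ}) = record
  { Carrier = ⊤ ; _≈_ = λ _ _ → ⊤
  ; isEquivalence = record { refl = _ ; sym = λ _ → _ ; trans = λ _ _ → _ } }
Edge unitHG _ = ⊥

_^⊠_ : ∀ {k c ℓ} → Hypergraph k c ℓ → ℕ → Hypergraph k c ℓ
H ^⊠ zero = unitHG
H ^⊠ suc n = (H ^⊠ n) ⊠ H

IsIndependent : ∀ {k c ℓ} (H : Hypergraph k c ℓ) → List (V H) → Set (c ⊔ ℓ)
IsIndependent H S =
  AllPairs (λ x y → ¬ (Hypergraph._≈_ H x y)) S
  × (∀ e → Edge H e → ¬ (∀ i → SetoidMembership._∈_ (vertices H) (e i) S))

Hcor : ∀ {c ℓ} → AbelianGroup c ℓ → Hypergraph 3 c ℓ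
vertices (Hcor G) = ×-setoid (AbelianGroup.setoid G) (AbelianGroup.setoid G)
Edge (Hcor G) e =
  ∃[ g₁ ] ∃[ g₂ ] ∃[ l ]
    (¬ (l ≈ ε))
    × (e zero ≈₂ (g₁ , g₂))
    × (e (suc zero) ≈₂ (g₁ ∙ l , g₂))
    × (e (suc (suc zero)) ≈₂ (g₁ , g₂ ∙ l))
  where
  open AbelianGroup G
  _≈₂_ = Setoid._≈_ (×-setoid (AbelianGroup.setoid G) (AbelianGroup.setoid G))

{-# OPTIONS --safe #-}
-- An edge of H = H_cor,G is a corner ((g₁ , g₂) , (g₁ + λ , g₂) , (g₁ , g₂ + λ)) with
-- λ ≠ 0, and a constant triple is a corner with λ = 0.  The set {((a , b) , (c , - a))}
-- ⊆ H ⊠ H of size |G|³ is independent: both projections of an edge inside it are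
-- corners, one of them proper, and matching the first coordinates of the first
-- corner against the negated second coordinates of the second forces both
-- differences to vanish.  Independent sets multiply under ⊠ and ⊠ is associative,
-- so H^⊠n has an independent set of size |G|^(3⌊n/2⌋), which exceeds (p/q)ⁿ for
-- large n as soon as p² < |G|³ q².
module Submission where

open import Defs
open import Data.Nat using (ℕ; _≤_; _<_; _*_; _^_)
open import Data.Fin using (Fin)
open import Data.List using (length)
open import Data.Product using (_×_; ∃-syntax)
open import Algebra.Bundles using (AbelianGroup)
open import Function.Bundles using (Inverse)
open import Relation.Binary.PropositionalEquality using (setoid)

open import Level using (_⊔_; lift)
open import Data.Nat using (zero; suc; _+_; z≤n; s≤s; ⌊_/2⌋; >-nonZero)
open import Data.Nat.Properties
open import Data.Fin using (remQuot)
open import Data.Fin.Patterns using (0F; 1F; 2F)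
open import Data.Fin.Properties using (*↔×)
open import Data.Product using (_,_; proj₁; proj₂; assocʳ′; assocˡ′)
import Data.Product as Product
open import Data.Product.Properties using (×-≡,≡→≡)
open import Data.Sum using (_⊎_; inj₁; inj₂)
open import Data.List using (tabulate)
open import Data.List.Properties using (length-tabulate)
open import Data.List.Relation.Unary.AllPairs.Properties using (tabulate⁺)
open import Data.List.Membership.Setoid.Properties using (∈-tabulate⁻)
open import Data.Unit.Polymorphic using (tt)
open import Function using (_∘_)
open import Function.Definitions using (Injective; Congruent)
open import Function.Properties.Inverse using (↔⇒↣; Inverse⇒Injection)
import Function.Construct.Symmetry as Symmetry
open import Function.Bundles using (Injection)
open import Relation.Nullary using (¬_)
open import Relation.Binary using (Rel)
open import Data.Product.Relation.Binary.Pointwise.NonDependent using (Pointwise)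
open import Relation.Binary.PropositionalEquality using (_≡_; refl; sym; trans; cong; subst)
open import Algebra.Properties.CommutativeSemigroup *-commutativeSemigroup using (x∙yz≈y∙xz)
import Algebra.Properties.Group as GroupProperties

open Hypergraph using (V; Edge; vertices)

module _ {k c ℓ} (H : Hypergraph k c ℓ) where
  open Hypergraph H using (_≈_) renaming (trans to ≈-trans; sym to ≈-sym)

  record IsIndependentFamily {n} (f : Fin n → V H) : Set (c ⊔ ℓ) where
    field
      injective : Injective _≡_ _≈_ f
      edge-free : ∀ e → Edge H e → ¬ (∀ t → ∃[ j ] e t ≈ f j)

  EdgeOrConstant : (Fin k → V H) → Set (c ⊔ ℓ)
  EdgeOrConstant e = Edge H e ⊎ AllEqual (vertices H) e

  tabulate-independent : ∀ {n} {f : Fin n → V H} → IsIndependentFamily f → IsIndependent H (tabulate f)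
  tabulate-independent F =
      tabulate⁺ (λ i≢j fi≈fj → i≢j (injective fi≈fj))
    , λ e edge e⊆f → edge-free e edge (λ t → ∈-tabulate⁻ (vertices H) (e⊆f t))
    where open IsIndependentFamily F

  singleton-independent : (∀ e → Edge H e → ¬ AllEqual (vertices H) e) →
                          (v : V H) → IsIndependentFamily (λ (_ : Fin 1) → v)
  singleton-independent loopless v = record
    { injective = λ { {0F} {0F} _ → refl }
    ; edge-free = λ e edge e≈v → loopless e edge
        (λ i j → ≈-trans (proj₂ (e≈v i)) (≈-sym (proj₂ (e≈v j))))
    }

module _ {k c ℓ} {K L : Hypergraph k c ℓ} {e : Fin k → V (K ⊠ L)} where

  ⊠-edge⇒edge⊎edge : Edge (K ⊠ L) e → Edge K (proj₁ ∘ e) ⊎ Edge L (proj₂ ∘ e)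
  ⊠-edge⇒edge⊎edge (inj₁ (_ , edgeL))          = inj₂ edgeL
  ⊠-edge⇒edge⊎edge (inj₂ (inj₁ (edgeK , _)))   = inj₁ edgeK
  ⊠-edge⇒edge⊎edge (inj₂ (inj₂ (edgeK , _)))   = inj₁ edgeK

  ⊠-edge⇒edgeOrConstantˡ : Edge (K ⊠ L) e → EdgeOrConstant K (proj₁ ∘ e)
  ⊠-edge⇒edgeOrConstantˡ (inj₁ (constK , _))        = inj₂ constK
  ⊠-edge⇒edgeOrConstantˡ (inj₂ (inj₁ (edgeK , _)))  = inj₁ edgeK
  ⊠-edge⇒edgeOrConstantˡ (inj₂ (inj₂ (edgeK , _)))  = inj₁ edgeK

  ⊠-edge⇒edgeOrConstantʳ : Edge (K ⊠ L) e → EdgeOrConstant L (proj₂ ∘ e)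
  ⊠-edge⇒edgeOrConstantʳ (inj₁ (_ , edgeL))         = inj₁ edgeL
  ⊠-edge⇒edgeOrConstantʳ (inj₂ (inj₁ (_ , constL))) = inj₂ constL
  ⊠-edge⇒edgeOrConstantʳ (inj₂ (inj₂ (_ , edgeL)))  = inj₁ edgeL

  edgeOrConstant⇒⊠-edge : EdgeOrConstant K (proj₁ ∘ e) → EdgeOrConstant L (proj₂ ∘ e) →
                          Edge K (proj₁ ∘ e) ⊎ Edge L (proj₂ ∘ e) → Edge (K ⊠ L) e
  edgeOrConstant⇒⊠-edge (inj₁ edgeK)  (inj₁ edgeL)  _             = inj₂ (inj₂ (edgeK , edgeL))
  edgeOrConstant⇒⊠-edge (inj₁ edgeK)  (inj₂ constL) _             = inj₂ (inj₁ (edgeK , constL))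
  edgeOrConstant⇒⊠-edge (inj₂ constK) (inj₁ edgeL)  _             = inj₁ (constK , edgeL)
  edgeOrConstant⇒⊠-edge (inj₂ _)      (inj₂ constL) (inj₁ edgeK)  = inj₂ (inj₁ (edgeK , constL))
  edgeOrConstant⇒⊠-edge (inj₂ constK) (inj₂ _)      (inj₂ edgeL)  = inj₁ (constK , edgeL)

module _ {k c ℓ} {K L M : Hypergraph k c ℓ} where

  ⊠-assocʳ-edge : ∀ e → Edge ((K ⊠ L) ⊠ M) e → Edge (K ⊠ (L ⊠ M)) (assocʳ′ ∘ e)
  ⊠-assocʳ-edge e edge =
    edgeOrConstant⇒⊠-edge {K = K} {L = L ⊠ M} {e = assocʳ′ ∘ e}
      edgeOrConstantK edgeOrConstantLM edgeK⊎edgeLM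
    where
    edgeOrConstantKL : EdgeOrConstant (K ⊠ L) (proj₁ ∘ e)
    edgeOrConstantKL = ⊠-edge⇒edgeOrConstantˡ {K = K ⊠ L} {L = M} edge

    edgeOrConstantM : EdgeOrConstant M (proj₂ ∘ e)
    edgeOrConstantM = ⊠-edge⇒edgeOrConstantʳ {K = K ⊠ L} {L = M} edge

    edgeOrConstantK : EdgeOrConstant K (proj₁ ∘ proj₁ ∘ e)
    edgeOrConstantK with edgeOrConstantKL
    ... | inj₁ edgeKL  = ⊠-edge⇒edgeOrConstantˡ {K = K} {L = L} edgeKL
    ... | inj₂ constKL = inj₂ (λ i j → proj₁ (constKL i j))

    edgeOrConstantL : EdgeOrConstant L (proj₂ ∘ proj₁ ∘ e)
    edgeOrConstantL with edgeOrConstantKL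
    ... | inj₁ edgeKL  = ⊠-edge⇒edgeOrConstantʳ {K = K} {L = L} edgeKL
    ... | inj₂ constKL = inj₂ (λ i j → proj₂ (constKL i j))

    edgeLM : Edge L (proj₂ ∘ proj₁ ∘ e) ⊎ Edge M (proj₂ ∘ e) → Edge (L ⊠ M) (proj₂ ∘ assocʳ′ ∘ e)
    edgeLM = edgeOrConstant⇒⊠-edge {K = L} {L = M} {e = proj₂ ∘ assocʳ′ ∘ e} edgeOrConstantL edgeOrConstantM

    edgeOrConstantLM : EdgeOrConstant (L ⊠ M) (proj₂ ∘ assocʳ′ ∘ e)
    edgeOrConstantLM with edgeOrConstantL | edgeOrConstantM
    ... | inj₁ edgeL  | _            = inj₁ (edgeLM (inj₁ edgeL))
    ... | inj₂ _      | inj₁ edgeM   = inj₁ (edgeLM (inj₂ edgeM))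
    ... | inj₂ constL | inj₂ constM  = inj₂ (λ i j → constL i j , constM i j)

    edgeK⊎edgeLM : Edge K (proj₁ ∘ proj₁ ∘ e) ⊎ Edge (L ⊠ M) (proj₂ ∘ assocʳ′ ∘ e)
    edgeK⊎edgeLM with ⊠-edge⇒edge⊎edge {K = K ⊠ L} {L = M} edge
    ... | inj₂ edgeM  = inj₂ (edgeLM (inj₂ edgeM))
    ... | inj₁ edgeKL with ⊠-edge⇒edge⊎edge {K = K} {L = L} edgeKL
    ...   | inj₁ edgeK = inj₁ edgeK
    ...   | inj₂ edgeL = inj₂ (edgeLM (inj₁ edgeL))

module _ {a b} {A : Set a} {B : Set b} where

  _⊗_ : ∀ {m n} → (Fin m → A) → (Fin n → B) → Fin (m * n) → A × B
  _⊗_ {n = n} f g = Product.map f g ∘ remQuot n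

  ⊗-injective : ∀ {ℓ₁ ℓ₂} {_≈₁_ : Rel A ℓ₁} {_≈₂_ : Rel B ℓ₂} {m n} {f : Fin m → A} {g : Fin n → B} →
                Injective _≡_ _≈₁_ f → Injective _≡_ _≈₂_ g →
                Injective _≡_ (Pointwise _≈₁_ _≈₂_) (f ⊗ g)
  ⊗-injective f-injective g-injective (fi≈fj , gi≈gj) =
    Injection.injective (↔⇒↣ *↔×) (×-≡,≡→≡ (f-injective fi≈fj , g-injective gi≈gj))

module _ {k c ℓ} {K L : Hypergraph k c ℓ} where
  open Hypergraph K using () renaming (_≈_ to _≈K_)
  open Hypergraph L using () renaming (_≈_ to _≈L_)

  preimage-independent : (φ : V L → V K) → Congruent _≈L_ _≈K_ φ →
                         (∀ e → Edge L e → Edge K (φ ∘ e)) →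
                         ∀ {n} {f : Fin n → V L} → IsIndependentFamily K (φ ∘ f) → IsIndependentFamily L f
  preimage-independent φ φ-cong φ-edge F = record
    { injective = injective ∘ φ-cong
    ; edge-free = λ e edge e⊆f → edge-free (φ ∘ e) (φ-edge e edge)
        (λ t → Product.map₂ φ-cong (e⊆f t))
    }
    where open IsIndependentFamily F

  ⊗-independent : ∀ {m n} {f : Fin m → V K} {g : Fin n → V L} →
                  IsIndependentFamily K f → IsIndependentFamily L g → IsIndependentFamily (K ⊠ L) (f ⊗ g)
  ⊗-independent {m} {n} {f} {g} F G = record
    { injective = ⊗-injective {_≈₁_ = _≈K_} {_≈₂_ = _≈L_} F.injective G.injective
    ; edge-free = edge-free
    }
    where
    module F = IsIndependentFamily F
    module G = IsIndependentFamily G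

    edge-free : ∀ e → Edge (K ⊠ L) e → ¬ (∀ t → ∃[ j ] Hypergraph._≈_ (K ⊠ L) (e t) ((f ⊗ g) j))
    edge-free e edge e⊆f⊗g with ⊠-edge⇒edge⊎edge {K = K} {L = L} edge
    ... | inj₁ edgeK =
      F.edge-free (proj₁ ∘ e) edgeK (Product.map (proj₁ ∘ remQuot {m} n) proj₁ ∘ e⊆f⊗g)
    ... | inj₂ edgeL =
      G.edge-free (proj₂ ∘ e) edgeL (Product.map (proj₂ ∘ remQuot {m} n) proj₂ ∘ e⊆f⊗g)

[1+k]*a^k≤[1+a]^[1+k] : ∀ a k → suc k * a ^ k ≤ suc a ^ suc k
[1+k]*a^k≤[1+a]^[1+k] a zero    = s≤s z≤n
[1+k]*a^k≤[1+a]^[1+k] a (suc k) = +-mono-≤ (^-monoˡ-≤ (suc k) (n≤1+n a)) (begin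
  suc k * (a * a ^ k)  ≡⟨ x∙yz≈y∙xz (suc k) a (a ^ k) ⟩
  a * (suc k * a ^ k)  ≤⟨ *-monoʳ-≤ a ([1+k]*a^k≤[1+a]^[1+k] a k) ⟩
  a * suc a ^ suc k    ∎)
  where open ≤-Reasoning

c*a^k≤b^k : ∀ {a b} c {k} → a < b → c * a < k → c * a ^ k ≤ b ^ k
c*a^k≤b^k {a} {b} c {suc k} a<b ca<1+k = begin
  c * (a * a ^ k)  ≡⟨ *-assoc c a (a ^ k) ⟨
  c * a * a ^ k    ≤⟨ *-monoˡ-≤ (a ^ k) (<⇒≤ ca<1+k) ⟩
  suc k * a ^ k    ≤⟨ [1+k]*a^k≤[1+a]^[1+k] a k ⟩
  suc a ^ suc k    ≤⟨ ^-monoˡ-≤ (suc k) a<b ⟩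
  b ^ suc k        ∎
  where open ≤-Reasoning

^-distribʳ-* : ∀ m n o → (m * n) ^ o ≡ m ^ o * n ^ o
^-distribʳ-* m n zero    = refl
^-distribʳ-* m n (suc o) =
  trans (cong (m * n *_) (^-distribʳ-* m n o)) ([m*n]*[o*p]≡[m*o]*[n*p] m n (m ^ o) (n ^ o))

n≡2⌊n/2⌋⊎n≡1+2⌊n/2⌋ : ∀ n → n ≡ 2 * ⌊ n /2⌋ ⊎ n ≡ suc (2 * ⌊ n /2⌋)
n≡2⌊n/2⌋⊎n≡1+2⌊n/2⌋ zero          = inj₁ refl
n≡2⌊n/2⌋⊎n≡1+2⌊n/2⌋ (suc zero)    = inj₂ refl
n≡2⌊n/2⌋⊎n≡1+2⌊n/2⌋ (suc (suc n)) with n≡2⌊n/2⌋⊎n≡1+2⌊n/2⌋ n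
... | inj₁ eq = inj₁ (trans (cong (2 +_) eq) (sym (*-suc 2 ⌊ n /2⌋)))
... | inj₂ eq = inj₂ (cong suc (trans (cong suc eq) (sym (*-suc 2 ⌊ n /2⌋))))

module _ {p q M : ℕ} (0<q : 0 < q) (p²<Mq² : p ^ 2 < M * q ^ 2) where
  open ≤-Reasoning

  private
    [Mq²]^k≡M^k*q^[2k] : ∀ k → (M * q ^ 2) ^ k ≡ M ^ k * q ^ (2 * k)
    [Mq²]^k≡M^k*q^[2k] k = trans (^-distribʳ-* M (q ^ 2) k) (cong (M ^ k *_) (^-*-assoc q 2 k))

  p^[2k]≤M^k*q^[2k] : ∀ k → p ^ (2 * k) ≤ M ^ k * q ^ (2 * k)
  p^[2k]≤M^k*q^[2k] k = begin
    p ^ (2 * k)         ≡⟨ ^-*-assoc p 2 k ⟨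
    (p ^ 2) ^ k         ≤⟨ ^-monoˡ-≤ k (<⇒≤ p²<Mq²) ⟩
    (M * q ^ 2) ^ k     ≡⟨ [Mq²]^k≡M^k*q^[2k] k ⟩
    M ^ k * q ^ (2 * k) ∎

  p^[1+2k]≤M^k*q^[1+2k] : ∀ k → p * p ^ 2 < k → p ^ suc (2 * k) ≤ M ^ k * q ^ suc (2 * k)
  p^[1+2k]≤M^k*q^[1+2k] k pp²<k = begin
    p * p ^ (2 * k)           ≡⟨ cong (p *_) (^-*-assoc p 2 k) ⟨
    p * (p ^ 2) ^ k           ≤⟨ c*a^k≤b^k p p²<Mq² pp²<k ⟩
    (M * q ^ 2) ^ k           ≤⟨ m≤n*m _ q {{>-nonZero 0<q}} ⟩
    q * (M * q ^ 2) ^ k       ≡⟨ cong (q *_) ([Mq²]^k≡M^k*q^[2k] k) ⟩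
    q * (M ^ k * q ^ (2 * k)) ≡⟨ x∙yz≈y∙xz q (M ^ k) (q ^ (2 * k)) ⟩
    M ^ k * (q * q ^ (2 * k)) ∎

  eventually-p^n≤M^⌊n/2⌋*q^n : ∃[ N ] ∀ n → N ≤ n → p ^ n ≤ M ^ ⌊ n /2⌋ * q ^ n
  eventually-p^n≤M^⌊n/2⌋*q^n = N , bound
    where
    N : ℕ
    N = suc (p * p ^ 2) + suc (p * p ^ 2)

    bound : ∀ n → N ≤ n → p ^ n ≤ M ^ ⌊ n /2⌋ * q ^ n
    bound n N≤n with n≡2⌊n/2⌋⊎n≡1+2⌊n/2⌋ n
    ... | inj₁ n≡2k   = subst (λ i → p ^ i ≤ M ^ ⌊ n /2⌋ * q ^ i) (sym n≡2k) (p^[2k]≤M^k*q^[2k] ⌊ n /2⌋)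
    ... | inj₂ n≡1+2k = subst (λ i → p ^ i ≤ M ^ ⌊ n /2⌋ * q ^ i) (sym n≡1+2k)
                          (p^[1+2k]≤M^k*q^[1+2k] ⌊ n /2⌋ pp²<⌊n/2⌋)
      where
      pp²<⌊n/2⌋ : p * p ^ 2 < ⌊ n /2⌋
      pp²<⌊n/2⌋ = subst (_≤ ⌊ n /2⌋) (sym (n≡⌊n+n/2⌋ _)) (⌊n/2⌋-mono N≤n)

module _ {c ℓ} (G : AbelianGroup c ℓ) where
  open AbelianGroup G using (Carrier; _≈_; _∙_; ε; _⁻¹; ⁻¹-cong; identityʳ; group)
    renaming (refl to ≈-refl; sym to ≈-sym; trans to ≈-trans)
  open GroupProperties group using (⁻¹-injective; identityʳ-unique)
  open Hypergraph (Hcor G) using () renaming (_≈_ to _≈₂_)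

  Corner : (Fin 3 → Carrier × Carrier) → Carrier → Set (c ⊔ ℓ)
  Corner v l = ∃[ g₁ ] ∃[ g₂ ]
    (v 0F ≈₂ (g₁ , g₂)) × (v 1F ≈₂ (g₁ ∙ l , g₂)) × (v 2F ≈₂ (g₁ , g₂ ∙ l))

  edge⇒corner : ∀ v → Edge (Hcor G) v → ∃[ l ] ¬ l ≈ ε × Corner v l
  edge⇒corner _ (g₁ , g₂ , l , l≉ε , corner) = l , l≉ε , g₁ , g₂ , corner

  edgeOrConstant⇒corner : ∀ v → EdgeOrConstant (Hcor G) v → ∃[ l ] Corner v l
  edgeOrConstant⇒corner v (inj₁ edge) = Product.map₂ proj₂ (edge⇒corner v edge)
  edgeOrConstant⇒corner v (inj₂ constant) = ε , proj₁ (v 0F) , proj₂ (v 0F) , (≈-refl , ≈-refl)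
    , (≈-trans (proj₁ (constant 1F 0F)) (≈-sym (identityʳ _)) , proj₂ (constant 1F 0F))
    , (proj₁ (constant 2F 0F) , ≈-trans (proj₂ (constant 2F 0F)) (≈-sym (identityʳ _)))

  Hcor-edge-nonconstant : ∀ e → Edge (Hcor G) e → ¬ AllEqual (vertices (Hcor G)) e
  Hcor-edge-nonconstant e (g₁ , g₂ , l , l≉ε , (e₀≈ , _) , (e₁≈ , _) , _) constant =
    l≉ε (identityʳ-unique g₁ l (≈-trans (≈-sym e₁≈) (≈-trans (proj₁ (constant 1F 0F)) e₀≈)))

  linked-corners-trivial : ∀ v w {l μ} → Corner v l → Corner w μ →
                           (∀ t → proj₂ (w t) ≈ proj₁ (v t) ⁻¹) → l ≈ ε × μ ≈ ε
  linked-corners-trivial _ _ {l} {μ} (g₁ , _ , v₀ , v₁ , v₂) (_ , h₂ , w₀ , w₁ , w₂) linked =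
      identityʳ-unique g₁ l (≈-sym (⁻¹-injective g₁⁻¹≈[g₁∙l]⁻¹))
    , identityʳ-unique h₂ μ h₂∙μ≈h₂
    where
    h₂≈g₁⁻¹ : h₂ ≈ g₁ ⁻¹
    h₂≈g₁⁻¹ = ≈-trans (≈-sym (proj₂ w₀)) (≈-trans (linked 0F) (⁻¹-cong (proj₁ v₀)))

    g₁⁻¹≈[g₁∙l]⁻¹ : g₁ ⁻¹ ≈ (g₁ ∙ l) ⁻¹
    g₁⁻¹≈[g₁∙l]⁻¹ = ≈-trans (≈-sym h₂≈g₁⁻¹)
      (≈-trans (≈-sym (proj₂ w₁)) (≈-trans (linked 1F) (⁻¹-cong (proj₁ v₁))))

    h₂∙μ≈h₂ : h₂ ∙ μ ≈ h₂
    h₂∙μ≈h₂ = ≈-trans (≈-sym (proj₂ w₂))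
      (≈-trans (linked 2F) (≈-trans (⁻¹-cong (proj₁ v₂)) (≈-sym h₂≈g₁⁻¹)))

  module _ {m} (x : Fin m → Carrier) (x-injective : Injective _≡_ _≈_ x) where

    cornerFree : Fin (m * (m * m)) → V (Hcor G ⊠ Hcor G)
    cornerFree i = let a , b , c = (x ⊗ (x ⊗ x)) i in (a , b) , (c , a ⁻¹)

    cornerFree-independent : IsIndependentFamily (Hcor G ⊠ Hcor G) cornerFree
    cornerFree-independent = record
      { injective = λ ((a≈ , b≈) , (c≈ , _)) →
          ⊗-injective {_≈₁_ = _≈_} {_≈₂_ = Pointwise _≈_ _≈_} x-injective
            (⊗-injective {_≈₁_ = _≈_} {_≈₂_ = _≈_} x-injective x-injective) (a≈ , b≈ , c≈)
      ; edge-free = edge-free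
      }
      where
      edge-free : ∀ e → Edge (Hcor G ⊠ Hcor G) e →
                  ¬ (∀ t → ∃[ j ] Hypergraph._≈_ (Hcor G ⊠ Hcor G) (e t) (cornerFree j))
      edge-free e edge e⊆S = refute (⊠-edge⇒edge⊎edge {K = Hcor G} {L = Hcor G} {e = e} edge)
        where
        v w : Fin 3 → Carrier × Carrier
        v = proj₁ ∘ e
        w = proj₂ ∘ e

        linked : ∀ t → proj₂ (w t) ≈ proj₁ (v t) ⁻¹
        linked t = let _ , ((a≈ , _) , (_ , a⁻¹≈)) = e⊆S t in ≈-trans a⁻¹≈ (⁻¹-cong (≈-sym a≈))

        refute : ¬ (Edge (Hcor G) v ⊎ Edge (Hcor G) w)
        refute (inj₁ edgeᵛ) =
          let l , l≉ε , cornerᵛ = edge⇒corner v edgeᵛ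
              _ , cornerʷ = edgeOrConstant⇒corner w
                              (⊠-edge⇒edgeOrConstantʳ {K = Hcor G} {L = Hcor G} {e = e} edge)
          in l≉ε (proj₁ (linked-corners-trivial v w cornerᵛ cornerʷ linked))
        refute (inj₂ edgeʷ) =
          let _ , cornerᵛ = edgeOrConstant⇒corner v
                              (⊠-edge⇒edgeOrConstantˡ {K = Hcor G} {L = Hcor G} {e = e} edge)
              μ , μ≉ε , cornerʷ = edge⇒corner w edgeʷ
          in μ≉ε (proj₂ (linked-corners-trivial v w cornerᵛ cornerʷ linked))

module _ {c ℓ} (G : AbelianGroup c ℓ) {m} (x : Fin m → AbelianGroup.Carrier G)
         (x-injective : Injective _≡_ (AbelianGroup._≈_ G) x) where
  open AbelianGroup G using (ε)

  private
    H : Hypergraph 3 c ℓ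
    H = Hcor G

  familySize : ℕ → ℕ
  familySize zero          = 1
  familySize (suc zero)    = 1
  familySize (suc (suc n)) = familySize n * (m * (m * m))

  familySize≡ : ∀ n → familySize n ≡ (m * (m * m)) ^ ⌊ n /2⌋
  familySize≡ zero          = refl
  familySize≡ (suc zero)    = refl
  familySize≡ (suc (suc n)) =
    trans (cong (_* (m * (m * m))) (familySize≡ n)) (*-comm _ (m * (m * m)))

  family : ∀ n → Fin (familySize n) → V (H ^⊠ n)
  family zero          = λ _ → tt
  family (suc zero)    = family zero ⊗ λ _ → ε , ε
  family (suc (suc n)) = assocˡ′ ∘ (family n ⊗ cornerFree G x x-injective)

  family-independent : ∀ n → IsIndependentFamily (H ^⊠ n) (family n)
  family-independent zero          = singleton-independent unitHG (λ { _ (lift ()) }) tt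
  family-independent (suc zero)    =
    ⊗-independent (family-independent zero) (singleton-independent H (Hcor-edge-nonconstant G) (ε , ε))
  family-independent (suc (suc n)) =
    preimage-independent assocʳ′ (λ ((a≈ , b≈) , c≈) → a≈ , b≈ , c≈)
      (⊠-assocʳ-edge {K = H ^⊠ n} {L = H} {M = H})
      (⊗-independent (family-independent n) (cornerFree-independent G x x-injective))

proposition2p11 : ∀ {c ℓ} (G : AbelianGroup c ℓ) (m : ℕ)
    → Inverse (AbelianGroup.setoid G) (setoid (Fin m))
    → ∀ (p q : ℕ) → 0 < q → p ^ 2 < (m ^ 3) * (q ^ 2)
    → ∃[ N ] (∀ n → N ≤ n → ∃[ S ] (IsIndependent (Hcor G ^⊠ n) S × (p ^ n ≤ length S * q ^ n)))
proposition2p11 G m G↔Fin p q 0<q p²<m³q² =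
  let N , bound = eventually-p^n≤M^⌊n/2⌋*q^n 0<q
                    (subst (λ M → p ^ 2 < M * q ^ 2) m³≡m*[m*m] p²<m³q²)
  in N , λ n N≤n →
       tabulate (family G x x-injective n)
     , tabulate-independent _ (family-independent G x x-injective n)
     , subst (λ L → p ^ n ≤ L * q ^ n)
         (sym (trans (length-tabulate _) (familySize≡ G x x-injective n))) (bound n N≤n)
  where
  x : Fin m → AbelianGroup.Carrier G
  x = Inverse.from G↔Fin

  x-injective : Injective _≡_ (AbelianGroup._≈_ G) x
  x-injective = Injection.injective (Inverse⇒Injection (Symmetry.inverse G↔Fin))

  m³≡m*[m*m] : m ^ 3 ≡ m * (m * m)
  m³≡m*[m*m] = cong (λ k → m * (m * k)) (*-identityʳ m)
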